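{- Let $G$ be a tree on $k\ge2$ vertices, $n\ge1$, and $e$ an edge of $G$. Then $\Gamma^G_n$ has exactly one $e$-cycle of length $2^n$, and for every integer $i$ with $0\le i<n$ the number of $e$-cycles of length $2^i$ in $\Gamma^G_n$ is \[ (k-2)\,k^{n-i-1}. \]
   Context: Let $G$ be a finite tree with vertex set $V$, $|V|=k$, and fix an orientation of each edge. For an oriented edge $e=(s,t)$ of $G$ define a bijection $e$ of the set $V^n$ of words of length $n$ over $V$ recursively: $e$ fixes the empty word, and for a letter $z\in V$ and a word $w$, $e(sw)=t\,e(w)$, $e(tw)=sw$, and $e(zw)=zw$ for $z\notin\{s,t\}$. The $n$-th Schreier graph $\Gamma^G_n$ is the multigraph with vertex set $V^n$ having, for each word $u\in V^n$ and each edge $e$ of $G$, one edge labelled $e$ joining $u$ and $e(u)$. For a fixed edge $e$, the edges labelled $e$ decompose into one cycle per orbit of $e$ on $V^n$: an orbit of size $m\ge3$ gives a cycle of length $m$, an orbit of size $2$ gives two parallel edges (a cycle of length $2$), and a fixed point gives a loop (a cycle of length $1$). These cycles are the $e$-cycles of $\Gamma^G_n$. -}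

module Defs where

open import Data.Nat using (ℕ; zero; suc; _≤_; _<_; _∸_)
open import Data.Fin using (Fin; _≟_)
open import Data.Vec using (Vec; []; _∷_)
open import Data.List using (List; length)
open import Data.List.Membership.Propositional using (_∈_)
open import Data.List.Relation.Unary.All using (All)
open import Data.List.Relation.Unary.Any using (Any)
open import Data.List.Relation.Unary.AllPairs using (AllPairs)
open import Data.Product using (Σ; ∃; _×_; _,_)
open import Data.Sum using (_⊎_)
open import Relation.Nullary using (¬_; yes; no)
open import Relation.Binary.PropositionalEquality using (_≡_; _≢_)

-- Vertex set V = Fin k.  A tree is given by its list of oriented edges (s , t).

Edge : ℕ → Set
Edge k = Fin k × Fin k

Adjacent : ∀ {k} → List (Edge k) → Fin k → Fin k → Set
Adjacent E u v = ((u , v) ∈ E) ⊎ ((v , u) ∈ E)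

data Walk {k} (E : List (Edge k)) : Fin k → Fin k → Set where
  stay : ∀ {u} → Walk E u u
  step : ∀ {u v w} → Adjacent E u v → Walk E v w → Walk E u w

-- A (finite) tree on k vertices: no loops, connected, with exactly k - 1 edges.
-- (A connected (multi)graph on k vertices with k - 1 edges is a tree.)
record IsTree (k : ℕ) (E : List (Edge k)) : Set where
  field
    noLoops   : All (λ e → Σ (Fin k) λ s → Σ (Fin k) λ t → (e ≡ (s , t)) × (s ≢ t)) E
    edgeCount : length E ≡ k ∸ 1
    connected : ∀ u v → Walk E u v

act : ∀ {k n} → Fin k → Fin k → Vec (Fin k) n → Vec (Fin k) n
act s t [] = []
act s t (z ∷ w) with z ≟ s
... | yes _ = t ∷ act s t w
... | no _ with z ≟ t
...   | yes _ = s ∷ w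
...   | no _  = z ∷ w

actIter : ∀ {k n} → Fin k → Fin k → ℕ → Vec (Fin k) n → Vec (Fin k) n
actIter s t zero w = w
actIter s t (suc j) w = act s t (actIter s t j w)

-- u lies in the orbit of w (the orbit of a permutation of a finite set
-- is its set of forward iterates)
SameOrbit : ∀ {k n} → Fin k → Fin k → Vec (Fin k) n → Vec (Fin k) n → Set
SameOrbit s t w u = ∃ λ j → actIter s t j w ≡ u

OrbitSize : ∀ {k n} → Fin k → Fin k → Vec (Fin k) n → ℕ → Set
OrbitSize s t w m =
  (1 ≤ m) × (actIter s t m w ≡ w) × (∀ p → 1 ≤ p → p < m → actIter s t p w ≢ w)

-- The number of e-cycles (orbits of e = (s , t) on V^n) of length m equals N:
-- there is a list of N words of orbit size m, pairwise in distinct orbits,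
-- and every word of orbit size m lies in the orbit of one of them.
NumCycles : ∀ {k} → Fin k → Fin k → (n m N : ℕ) → Set
NumCycles {k} s t n m N =
  Σ (List (Vec (Fin k) n)) λ reps →
    (length reps ≡ N)
    × All (λ r → OrbitSize s t r m) reps
    × AllPairs (λ u v → ¬ SameOrbit s t u v) reps
    × (∀ w → OrbitSize s t w m → Any (λ r → SameOrbit s t r w) reps)

{-# OPTIONS --safe #-}
module Submission where

-- A word whose first letter is neither s nor t is fixed by e. On a word a w with a ∈ {s, t},
-- e toggles the first letter between s and t while e² acts as e on the tail, so the orbit of
-- a w is exactly twice as long as the orbit of w. Hence w ↦ t w turns the e-cycles of length m
-- in Γₙ into the e-cycles of length 2m in Γₙ₊₁. Iterating from the single cycle of Γ₀ gives the
-- cycle of length 2ⁿ, and iterating from the (k - 2) kⁿ⁻ⁱ⁻¹ loops of Γₙ₋ᵢ gives the cycles of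
-- length 2ⁱ.

open import Defs
open import Data.Nat using (ℕ; zero; suc; _≤_; _<_; _+_; _*_; _∸_; _^_; s≤s; z≤n)
open import Data.Nat.Properties using (≤-trans; m≤m+n; *-suc; *-monoʳ-≤; *-monoʳ-<; <⇒≱; ≰⇒>; even≢odd)
open import Data.Fin using (Fin; _≟_)
open import Data.Vec using (Vec; []; _∷_)
open import Data.Vec.Properties using (∷-injectiveˡ; ∷-injectiveʳ; ∷-injective)
open import Data.List using (List; []; _∷_; [_]; _++_; length; map; filter; allFin; cartesianProductWith)
open import Data.List.Properties using (length-map; length-++; length-tabulate; filter-all)
open import Data.List.Membership.Propositional using (_∈_)
open import Data.List.Membership.Propositional.Properties
  using (∈-allFin; ∈-filter⁺; ∈-filter⁻; ∈-cartesianProductWith⁺; ∈-cartesianProductWith⁻)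
open import Data.List.Relation.Unary.All as All using (All; []; _∷_)
import Data.List.Relation.Unary.All.Properties as Allₚ
open import Data.List.Relation.Unary.Any as Any using (Any; here; there)
import Data.List.Relation.Unary.Any.Properties as Anyₚ
open import Data.List.Relation.Unary.AllPairs as AllPairs using (AllPairs; []; _∷_)
import Data.List.Relation.Unary.AllPairs.Properties as AllPairsₚ
open import Data.List.Relation.Unary.Unique.Propositional using (Unique)
import Data.List.Relation.Unary.Unique.Propositional.Properties as Uniqueₚ
open import Data.Product using (_×_; _,_)
open import Data.Sum using (_⊎_; inj₁; inj₂; [_,_]′)
open import Function using (_∘_)
open import Relation.Nullary using (¬_; yes; no; ¬?; contradiction)
open import Relation.Nullary.Decidable using (Dec; _⊎-dec_)
open import Relation.Binary.Definitions using (DecidableEquality)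
open import Relation.Binary.PropositionalEquality
  using (_≡_; _≢_; refl; sym; trans; cong; cong₂; ≢-sym; module ≡-Reasoning)

open ≡-Reasoning

length-cartesianProductWith : ∀ {A B C : Set} (f : A → B → C) xs ys →
  length (cartesianProductWith f xs ys) ≡ length xs * length ys
length-cartesianProductWith f [] ys = refl
length-cartesianProductWith f (x ∷ xs) ys = begin
  length (map (f x) ys ++ cartesianProductWith f xs ys)
    ≡⟨ length-++ (map (f x) ys) ⟩
  length (map (f x) ys) + length (cartesianProductWith f xs ys)
    ≡⟨ cong₂ _+_ (length-map (f x) ys) (length-cartesianProductWith f xs ys) ⟩
  length ys + length xs * length ys
    ∎

length-allFin : ∀ k → length (allFin k) ≡ k
length-allFin k = length-tabulate {n = k} (λ i → i)

module _ {A : Set} (_≟ᴬ_ : DecidableEquality A) where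

  remove : A → List A → List A
  remove x = filter (λ y → ¬? (y ≟ᴬ x))

  ∈-remove⁺ : ∀ {x y xs} → y ∈ xs → y ≢ x → y ∈ remove x xs
  ∈-remove⁺ {x} = ∈-filter⁺ (λ y → ¬? (y ≟ᴬ x))

  ∈-remove⁻ : ∀ {x y} xs → y ∈ remove x xs → y ∈ xs × y ≢ x
  ∈-remove⁻ {x} xs = ∈-filter⁻ (λ y → ¬? (y ≟ᴬ x)) {xs = xs}

  remove-unique : ∀ {x xs} → Unique xs → Unique (remove x xs)
  remove-unique {x} = Uniqueₚ.filter⁺ (λ y → ¬? (y ≟ᴬ x))

  length-remove : ∀ {x xs} → Unique xs → x ∈ xs → suc (length (remove x xs)) ≡ length xs
  length-remove {x} {y ∷ ys} (y∉ys ∷ _) _ with y ≟ᴬ x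
  ... | yes refl = cong (suc ∘ length) (filter-all (λ z → ¬? (z ≟ᴬ x)) (All.map ≢-sym y∉ys))
  length-remove (_ ∷ _) (here refl) | no x≢x = contradiction refl x≢x
  length-remove (_ ∷ unique) (there x∈ys) | no _ = cong suc (length-remove unique x∈ys)

module _ {A : Set} where

  words : List A → ∀ n → List (Vec A n)
  words xs zero = [ [] ]
  words xs (suc n) = cartesianProductWith _∷_ xs (words xs n)

  length-words : ∀ xs n → length (words xs n) ≡ length xs ^ n
  length-words xs zero = refl
  length-words xs (suc n) = trans (length-cartesianProductWith _∷_ xs (words xs n))
                                  (cong (length xs *_) (length-words xs n))

  words-unique : ∀ {xs} → Unique xs → ∀ n → Unique (words xs n)
  words-unique unique zero = [] ∷ []
  words-unique unique (suc n) =
    Uniqueₚ.cartesianProductWith⁺ _∷_ ∷-injective unique (words-unique unique n)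

  ∈-words : ∀ {xs} → (∀ x → x ∈ xs) → ∀ {n} (w : Vec A n) → w ∈ words xs n
  ∈-words complete [] = here refl
  ∈-words complete (x ∷ w) = ∈-cartesianProductWith⁺ _∷_ (complete x) (∈-words complete w)

data EvenOdd : ℕ → Set where
  even : ∀ q → EvenOdd (2 * q)
  odd  : ∀ q → EvenOdd (suc (2 * q))

evenOdd : ∀ n → EvenOdd n
evenOdd zero = even zero
evenOdd (suc n) with evenOdd n
... | even q = odd q
... | odd q rewrite sym (*-suc 2 q) = even (suc q)

module _ {k : ℕ} {s t : Fin k} where

  Endpoint : Fin k → Set
  Endpoint a = a ≡ s ⊎ a ≡ t

  endpoint? : ∀ a → Dec (Endpoint a)
  endpoint? a = (a ≟ s) ⊎-dec (a ≟ t)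

  act-s : ∀ {n} (w : Vec (Fin k) n) → act s t (s ∷ w) ≡ t ∷ act s t w
  act-s w with s ≟ s
  ... | yes _  = refl
  ... | no s≢s = contradiction refl s≢s

  act-other : ∀ {n z} (w : Vec (Fin k) n) → ¬ Endpoint z → act s t (z ∷ w) ≡ z ∷ w
  act-other {z = z} w ¬ez with z ≟ s
  ... | yes z≡s = contradiction (inj₁ z≡s) ¬ez
  ... | no _ with z ≟ t
  ...   | yes z≡t = contradiction (inj₂ z≡t) ¬ez
  ...   | no _    = refl

  actIter-fixed : ∀ {n} {w : Vec (Fin k) n} → act s t w ≡ w → ∀ j → actIter s t j w ≡ w
  actIter-fixed fixed zero = refl
  actIter-fixed fixed (suc j) = trans (cong (act s t) (actIter-fixed fixed j)) fixed

  orbitSize-fixed : ∀ {n} {w : Vec (Fin k) n} → act s t w ≡ w → OrbitSize s t w 1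
  orbitSize-fixed fixed = s≤s z≤n , fixed , λ { zero () _ ; (suc p) _ (s≤s ()) }

  fixed⇒orbitSize≡1 : ∀ {n m} {w : Vec (Fin k) n} → act s t w ≡ w → OrbitSize s t w m → m ≡ 1
  fixed⇒orbitSize≡1 {m = zero} _ (() , _)
  fixed⇒orbitSize≡1 {m = suc zero} _ _ = refl
  fixed⇒orbitSize≡1 {m = suc (suc m)} fixed (_ , _ , minimal) =
    contradiction fixed (minimal 1 (s≤s z≤n) (s≤s (s≤s z≤n)))

  fixed-unique⇒¬sameOrbit : ∀ {n} {us : List (Vec (Fin k) n)} →
    All (λ u → act s t u ≡ u) us → Unique us → AllPairs (λ u v → ¬ SameOrbit s t u v) us
  fixed-unique⇒¬sameOrbit [] [] = []
  fixed-unique⇒¬sameOrbit (fixed ∷ fixeds) (u∉ ∷ unique) =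
    All.map (λ u≢v (j , uʲ≡v) → u≢v (trans (sym (actIter-fixed fixed j)) uʲ≡v)) u∉
    ∷ fixed-unique⇒¬sameOrbit fixeds unique

  otherLetters : List (Fin k)
  otherLetters = remove _≟_ t (remove _≟_ s (allFin k))

  ∈-otherLetters⁺ : ∀ {z} → ¬ Endpoint z → z ∈ otherLetters
  ∈-otherLetters⁺ {z} ¬ez =
    ∈-remove⁺ _≟_ (∈-remove⁺ _≟_ (∈-allFin z) (¬ez ∘ inj₁)) (¬ez ∘ inj₂)

  ∈-otherLetters⁻ : ∀ {z} → z ∈ otherLetters → ¬ Endpoint z
  ∈-otherLetters⁻ z∈
    with z∈′ , z≢t ← ∈-remove⁻ _≟_ (remove _≟_ s (allFin k)) z∈
    with _ , z≢s ← ∈-remove⁻ _≟_ (allFin k) z∈′ = [ z≢s , z≢t ]′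

  otherLetters-unique : Unique otherLetters
  otherLetters-unique = remove-unique _≟_ (remove-unique _≟_ (Uniqueₚ.allFin⁺ k))

  module _ (s≢t : s ≢ t) where

    act-t : ∀ {n} (w : Vec (Fin k) n) → act s t (t ∷ w) ≡ s ∷ w
    act-t w with t ≟ s
    ... | yes t≡s = contradiction (sym t≡s) s≢t
    ... | no _ with t ≟ t
    ...   | yes _  = refl
    ...   | no t≢t = contradiction refl t≢t

    act²-endpoint : ∀ {n a} → Endpoint a → (w : Vec (Fin k) n) →
      act s t (act s t (a ∷ w)) ≡ a ∷ act s t w
    act²-endpoint (inj₁ refl) w = trans (cong (act s t) (act-s w)) (act-t (act s t w))
    act²-endpoint (inj₂ refl) w = trans (cong (act s t) (act-t w)) (act-s w)

    act-moves-endpoint : ∀ {n a} → Endpoint a → (w v : Vec (Fin k) n) → act s t (a ∷ w) ≢ a ∷ v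
    act-moves-endpoint (inj₁ refl) w v eq = s≢t (sym (∷-injectiveˡ (trans (sym (act-s w)) eq)))
    act-moves-endpoint (inj₂ refl) w v eq = s≢t (∷-injectiveˡ (trans (sym (act-t w)) eq))

    actIter-double : ∀ {n a} → Endpoint a → ∀ q (w : Vec (Fin k) n) →
      actIter s t (2 * q) (a ∷ w) ≡ a ∷ actIter s t q w
    actIter-double ea zero w = refl
    actIter-double {a = a} ea (suc q) w = begin
      actIter s t (2 * suc q) (a ∷ w)
        ≡⟨ cong (λ j → actIter s t j (a ∷ w)) (*-suc 2 q) ⟩
      act s t (act s t (actIter s t (2 * q) (a ∷ w)))
        ≡⟨ cong (act s t ∘ act s t) (actIter-double ea q w) ⟩
      act s t (act s t (a ∷ actIter s t q w))
        ≡⟨ act²-endpoint ea (actIter s t q w) ⟩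
      a ∷ actIter s t (suc q) w
        ∎

    actIter-odd : ∀ {n a} → Endpoint a → ∀ q (w v : Vec (Fin k) n) →
      actIter s t (suc (2 * q)) (a ∷ w) ≢ a ∷ v
    actIter-odd ea q w v eq =
      act-moves-endpoint ea (actIter s t q w) v (trans (sym (cong (act s t) (actIter-double ea q w))) eq)

    orbitSize-double : ∀ {n a m} {w : Vec (Fin k) n} → Endpoint a →
      OrbitSize s t w m → OrbitSize s t (a ∷ w) (2 * m)
    orbitSize-double {a = a} {m} {w} ea (0<m , period , minimal) =
      ≤-trans 0<m (m≤m+n m _) , trans (actIter-double ea m w) (cong (a ∷_) period) ,
      λ p → minimal₂ (evenOdd p)
      where
      minimal₂ : ∀ {p} → EvenOdd p → 1 ≤ p → p < 2 * m → actIter s t p (a ∷ w) ≢ a ∷ w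
      minimal₂ (even zero) ()
      minimal₂ (even (suc q)) _ p<2m eq =
        minimal (suc q) (s≤s z≤n) (≰⇒> (λ m≤q → <⇒≱ p<2m (*-monoʳ-≤ 2 m≤q)))
          (∷-injectiveʳ (trans (sym (actIter-double ea (suc q) w)) eq))
      minimal₂ (odd q) _ _ = actIter-odd ea q w w

    orbitSize-halve : ∀ {n a m} {w : Vec (Fin k) n} → Endpoint a →
      OrbitSize s t (a ∷ w) (2 * m) → OrbitSize s t w m
    orbitSize-halve {m = zero} _ (() , _)
    orbitSize-halve {a = a} {suc m} {w} ea (_ , period , minimal) =
      s≤s z≤n , ∷-injectiveʳ (trans (sym (actIter-double ea (suc m) w)) period) ,
      λ p 0<p p<m wᵖ≡w → minimal (2 * p) (≤-trans 0<p (m≤m+n p _)) (*-monoʳ-< 2 p<m)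
                            (trans (actIter-double ea p w) (cong (a ∷_) wᵖ≡w))

    sameOrbit-∷⁻ : ∀ {n a} {u v : Vec (Fin k) n} → Endpoint a →
      SameOrbit s t (a ∷ u) (a ∷ v) → SameOrbit s t u v
    sameOrbit-∷⁻ {a = a} {u} {v} ea (j , eq) = halve (evenOdd j) eq
      where
      halve : ∀ {j} → EvenOdd j → actIter s t j (a ∷ u) ≡ a ∷ v → SameOrbit s t u v
      halve (even q) eq = q , ∷-injectiveʳ (trans (sym (actIter-double ea q u)) eq)
      halve (odd q) eq = contradiction eq (actIter-odd ea q u v)

    sameOrbit-∷⁺ : ∀ {n b} {u w : Vec (Fin k) n} → Endpoint b →
      SameOrbit s t u w → SameOrbit s t (t ∷ u) (b ∷ w)
    sameOrbit-∷⁺ {u = u} (inj₁ refl) (j , uʲ≡w) =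
      suc (2 * j) ,
      trans (cong (act s t) (actIter-double (inj₂ refl) j u)) (trans (act-t _) (cong (s ∷_) uʲ≡w))
    sameOrbit-∷⁺ {u = u} (inj₂ refl) (j , uʲ≡w) =
      2 * j , trans (actIter-double (inj₂ refl) j u) (cong (t ∷_) uʲ≡w)

    numCycles-double : ∀ {n m N} → NumCycles s t n m N → NumCycles s t (suc n) (2 * m) N
    numCycles-double {m = m} (reps , length≡N , sizes , distinct , cover) =
      map (t ∷_) reps , trans (length-map (t ∷_) reps) length≡N ,
      Allₚ.map⁺ (All.map (orbitSize-double (inj₂ refl)) sizes) ,
      AllPairsₚ.map⁺ (AllPairs.map (_∘ sameOrbit-∷⁻ (inj₂ refl)) distinct) ,
      cover₂
      where
      cover₂ : ∀ w → OrbitSize s t w (2 * m) → Any (λ r → SameOrbit s t r w) (map (t ∷_) reps)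
      cover₂ (z ∷ w) size with endpoint? z
      ... | yes ez  = Anyₚ.map⁺ (Any.map (sameOrbit-∷⁺ ez) (cover w (orbitSize-halve ez size)))
      ... | no ¬ez = contradiction (fixed⇒orbitSize≡1 (act-other w ¬ez) size) (even≢odd m 0)

    numCycles-full : ∀ n → NumCycles s t n (2 ^ n) 1
    numCycles-full zero =
      [ [] ] , refl , orbitSize-fixed refl ∷ [] , [] ∷ [] , λ { [] _ → here (0 , refl) }
    numCycles-full (suc n) = numCycles-double (numCycles-full n)

    length-otherLetters : length otherLetters ≡ k ∸ 2
    length-otherLetters = cong (_∸ 2) (begin
      suc (suc (length otherLetters))
        ≡⟨ cong suc (length-remove _≟_ (remove-unique _≟_ (Uniqueₚ.allFin⁺ k))
                       (∈-remove⁺ _≟_ (∈-allFin t) (s≢t ∘ sym))) ⟩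
      suc (length (remove _≟_ s (allFin k)))
        ≡⟨ length-remove _≟_ (Uniqueₚ.allFin⁺ k) (∈-allFin s) ⟩
      length (allFin k)
        ≡⟨ length-allFin k ⟩
      k ∎)

    numCycles-loops : ∀ n → NumCycles s t (suc n) 1 ((k ∸ 2) * k ^ n)
    numCycles-loops n =
      fixedWords , length-fixedWords , All.map orbitSize-fixed fixed ,
      fixed-unique⇒¬sameOrbit fixed fixedWords-unique , cover
      where
      fixedWords : List (Vec (Fin k) (suc n))
      fixedWords = cartesianProductWith _∷_ otherLetters (words (allFin k) n)

      length-fixedWords : length fixedWords ≡ (k ∸ 2) * k ^ n
      length-fixedWords = begin
        length fixedWords
          ≡⟨ length-cartesianProductWith _∷_ otherLetters (words (allFin k) n) ⟩
        length otherLetters * length (words (allFin k) n)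
          ≡⟨ cong₂ _*_ length-otherLetters (length-words (allFin k) n) ⟩
        (k ∸ 2) * length (allFin k) ^ n
          ≡⟨ cong (λ l → (k ∸ 2) * l ^ n) (length-allFin k) ⟩
        (k ∸ 2) * k ^ n ∎

      fixedWords-unique : Unique fixedWords
      fixedWords-unique = Uniqueₚ.cartesianProductWith⁺ _∷_ ∷-injective otherLetters-unique
                            (words-unique (Uniqueₚ.allFin⁺ k) n)

      fixed : All (λ u → act s t u ≡ u) fixedWords
      fixed = All.tabulate fixedWord
        where
        fixedWord : ∀ {u} → u ∈ fixedWords → act s t u ≡ u
        fixedWord u∈
          with _ , w , z∈ , _ , refl ← ∈-cartesianProductWith⁻ _∷_ otherLetters (words (allFin k) n) u∈
          = act-other w (∈-otherLetters⁻ z∈)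

      cover : ∀ u → OrbitSize s t u 1 → Any (λ r → SameOrbit s t r u) fixedWords
      cover (z ∷ w) (_ , period , _) with endpoint? z
      ... | yes ez  = contradiction period (act-moves-endpoint ez w w)
      ... | no ¬ez = Any.map (λ zw≡r → 0 , sym zw≡r)
                       (∈-cartesianProductWith⁺ _∷_ (∈-otherLetters⁺ ¬ez) (∈-words ∈-allFin w))

    numCycles-below : ∀ i n → i < n → NumCycles s t n (2 ^ i) ((k ∸ 2) * k ^ (n ∸ i ∸ 1))
    numCycles-below zero (suc n) _ = numCycles-loops n
    numCycles-below (suc i) (suc n) (s≤s i<n) = numCycles-double (numCycles-below i n i<n)

mainTheorem6 : (k : ℕ) → 2 ≤ k → (E : List (Edge k)) → IsTree k E →
    (n : ℕ) → 1 ≤ n → (s t : Fin k) → (s , t) ∈ E →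
    NumCycles s t n (2 ^ n) 1
    × (∀ i → i < n → NumCycles s t n (2 ^ i) ((k ∸ 2) * k ^ (n ∸ i ∸ 1)))
mainTheorem6 k _ E tree n _ s t st∈E
  with _ , _ , refl , s≢t ← All.lookup (IsTree.noLoops tree) st∈E =
  numCycles-full s≢t n , λ i → numCycles-below s≢t i n
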